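{- The graph $\mathcal{G}_3$ has finitely many connected components.
   Context: A square is a finite non-empty word of the form $XX$ with $X$ non-empty. If $W=UXXV$ with $X$ non-empty, replacing $W$ by $UXV$ is a square reduction. For $k\geqslant1$, $\mathcal{G}_k$ is the (undirected, infinite) graph whose vertex set is the set of all finite non-empty words over a fixed alphabet of size $k$, in which two words $U,W$ are adjacent whenever one of them can be obtained from the other by a single square reduction. -}

module Defs where

open import Data.Nat using (ℕ)
open import Data.Fin using (Fin)
open import Data.List using (List; _++_; [])
open import Data.List.NonEmpty using (List⁺; toList)
open import Data.List.Membership.Propositional using (_∈_)
open import Data.Product using (Σ; ∃; _×_)
open import Data.Sum using (_⊎_)
open import Relation.Binary.PropositionalEquality using (_≡_; _≢_)
open import Relation.Binary.Construct.Closure.ReflexiveTransitive using (Star)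

Word : ℕ → Set
Word k = List⁺ (Fin k)

SquareReduction : {k : ℕ} → Word k → Word k → Set
SquareReduction {k} W W' =
  Σ (List (Fin k)) λ U → Σ (List (Fin k)) λ X → Σ (List (Fin k)) λ V →
    (X ≢ []) × (toList W ≡ U ++ X ++ X ++ V) × (toList W' ≡ U ++ X ++ V)

Adjacent : {k : ℕ} → Word k → Word k → Set
Adjacent U W = SquareReduction U W ⊎ SquareReduction W U

Connected : {k : ℕ} → Word k → Word k → Set
Connected = Star Adjacent

FinitelyManyComponents : ℕ → Set
FinitelyManyComponents k =
  Σ (List (Word k)) λ reps → (W : Word k) → Σ (Word k) λ R → (R ∈ reps) × Connected W R

-- Square reductions and their inverses generate the congruence of the free band, and the free
-- band on finitely many generators is finite. Concretely: if p a is the shortest prefix of w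
-- containing every letter of w and b s the shortest such suffix, then w ≈ p a b s. Since a does
-- not occur in p and b does not occur in s, induction on the number of letters shows that every
-- word over n letters is equivalent to one of length at most L n, where L 0 = 0 and
-- L (n + 1) = 2 L n + 2. Hence the words of length at most L k meet every component of G_k.
module Submission where

open import Defs
open import Data.Empty using (⊥-elim)
open import Data.Fin using (_≟_)
open import Data.List using (List; []; _∷_; _++_; [_]; length; filter; cartesianProductWith; allFin)
open import Data.List.Membership.Propositional using (_∈_; _∉_)
open import Data.List.Membership.Propositional.Properties using (∈-∃++; ∈-++⁻; ∈-filter⁺; ∈-cartesianProductWith⁺; ∈-allFin)
import Data.List.Membership.DecPropositional as DecMembership
open import Data.List.NonEmpty as List⁺ using (List⁺; toList)
open import Data.List.Properties using (++-assoc; ++-identityʳ; ++-monoid; ++-conicalˡ; ++-conicalʳ; length-++; length-tabulate; filter-notAll)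
open import Data.List.Relation.Binary.Subset.Propositional using (_⊆_)
open import Data.List.Relation.Binary.Subset.Propositional.Properties using (xs⊆xs++ys; xs⊆ys++xs)
open import Data.List.Relation.Unary.Any as Any using (here; there)
open import Data.List.Reverse using (Reverse; reverseView; []; _∶_∶ʳ_)
open import Data.Nat using (ℕ; zero; suc; _+_; _≤_; _<_; z≤n; s≤s)
open import Data.Nat.Properties using (≤-trans; ≤-reflexive; ≤-pred; n≤1+n; +-mono-≤)
open import Data.Product using (Σ; _×_; _,_; proj₂)
open import Data.Sum using (inj₁; inj₂)
open import Function using (id; _∘_)
open import Relation.Binary.Bundles using (Setoid)
open import Relation.Binary.Construct.Closure.Equivalence using (EqClosure; setoid; gmap; return)
open import Relation.Binary.Construct.Closure.ReflexiveTransitive using (ε; _◅_)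
open import Relation.Binary.Construct.Closure.Symmetric using (fwd; bwd)
open import Relation.Binary.Definitions using (DecidableEquality)
open import Relation.Binary.PropositionalEquality using (_≡_; _≢_; refl; sym; trans; cong; subst₂)
import Relation.Binary.Reasoning.Setoid as SetoidReasoning
open import Relation.Nullary using (¬?; yes; no)
open import Tactic.MonoidSolver using (solve)

lengthBound : ℕ → ℕ
lengthBound zero    = 0
lengthBound (suc n) = lengthBound n + (2 + lengthBound n)

module _ {A : Set} where

  Reduction : List A → List A → Set
  Reduction w w′ = Σ (List A) λ U → Σ (List A) λ X → Σ (List A) λ V →
    (X ≢ []) × (w ≡ U ++ X ++ X ++ V) × (w′ ≡ U ++ X ++ V)

  infix 4 _≈_
  _≈_ : List A → List A → Set
  _≈_ = EqClosure Reduction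

  open Setoid (setoid Reduction) using () renaming (sym to ≈-sym)
  open SetoidReasoning (setoid Reduction)

  reduction-++ˡ : ∀ l {w w′} → Reduction w w′ → Reduction (l ++ w) (l ++ w′)
  reduction-++ˡ l (U , X , V , X≢[] , refl , refl) =
    l ++ U , X , V , X≢[] , sym (++-assoc l U _) , sym (++-assoc l U _)

  reduction-++ʳ : ∀ r {w w′} → Reduction w w′ → Reduction (w ++ r) (w′ ++ r)
  reduction-++ʳ r (U , X , V , X≢[] , refl , refl) =
    U , X , V ++ r , X≢[] , solve (++-monoid A) , solve (++-monoid A)

  ≈-++ˡ : ∀ l {w w′} → w ≈ w′ → l ++ w ≈ l ++ w′
  ≈-++ˡ l = gmap (l ++_) (reduction-++ˡ l)

  ≈-++ʳ : ∀ r {w w′} → w ≈ w′ → w ++ r ≈ w′ ++ r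
  ≈-++ʳ r = gmap (_++ r) (reduction-++ʳ r)

  ≈-++ : ∀ {u u′ v v′} → u ≈ u′ → v ≈ v′ → u ++ v ≈ u′ ++ v′
  ≈-++ {u} {u′} {v} {v′} u≈u′ v≈v′ = begin
    u ++ v   ≈⟨ ≈-++ʳ v u≈u′ ⟩
    u′ ++ v  ≈⟨ ≈-++ˡ u′ v≈v′ ⟩
    u′ ++ v′ ∎

  -- An empty X makes both sides equal, so no side condition is needed.
  unsquare : ∀ U X V → U ++ X ++ X ++ V ≈ U ++ X ++ V
  unsquare U []      V = ε
  unsquare U (x ∷ X) V = return (U , x ∷ X , V , (λ ()) , refl , refl)

  unsquareʳ : ∀ U X → U ++ X ++ X ≈ U ++ X
  unsquareʳ U X =
    subst₂ _≈_ (cong (λ t → U ++ X ++ t) (++-identityʳ X)) (cong (U ++_) (++-identityʳ X))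
      (unsquare U X [])

  ≈-dupPrefix : ∀ {w x q} → w ≡ x ++ q → w ≈ x ++ w
  ≈-dupPrefix {x = x} {q} refl = ≈-sym (unsquare [] x q)

  ≈-dupSuffix : ∀ {w r z} → w ≡ r ++ z → w ≈ w ++ z
  ≈-dupSuffix {r = r} {z} refl = begin
    r ++ z        ≈⟨ unsquareʳ r z ⟨
    r ++ z ++ z   ≡⟨ ++-assoc r z z ⟨
    (r ++ z) ++ z ∎

  prefix⊆ : ∀ {w u v : List A} → w ≡ u ++ v → u ⊆ w
  prefix⊆ {u = u} {v} refl = xs⊆xs++ys u v

  suffix⊆ : ∀ {w u v : List A} → w ≡ u ++ v → v ⊆ w
  suffix⊆ {u = u} {v} refl = xs⊆ys++xs v u

  ≈-factor : ∀ {x u C v} → x ≡ u ++ C ++ v → x ≈ x ++ C ++ x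
  ≈-factor {u = u} {C} {v} refl = begin
    u ++ C ++ v
      ≈⟨ ≈-dupPrefix {x = u ++ C} (sym (++-assoc u C v)) ⟩
    (u ++ C) ++ u ++ C ++ v
      ≡⟨ solve (++-monoid A) ⟩
    u ++ (C ++ u ++ C ++ v)
      ≈⟨ unsquareʳ u (C ++ u ++ C ++ v) ⟨
    u ++ (C ++ u ++ C ++ v) ++ (C ++ u ++ C ++ v)
      ≡⟨ solve (++-monoid A) ⟩
    (u ++ C) ++ (u ++ C) ++ (v ++ C ++ u ++ C ++ v)
      ≈⟨ unsquare [] (u ++ C) (v ++ C ++ u ++ C ++ v) ⟩
    (u ++ C) ++ (v ++ C ++ u ++ C ++ v)
      ≡⟨ solve (++-monoid A) ⟩
    (u ++ C ++ v) ++ C ++ (u ++ C ++ v) ∎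

  absorb-++ : ∀ {x C y} → x ≈ x ++ C ++ x → x ++ C ≈ (x ++ C) ++ y ++ (x ++ C) →
                x ≈ x ++ (C ++ y) ++ x
  absorb-++ {x} {C} {y} x≈xCx xC≈xCyxC = begin
    x                                ≈⟨ x≈xCx ⟩
    x ++ C ++ x                      ≡⟨ ++-assoc x C x ⟨
    (x ++ C) ++ x                    ≈⟨ ≈-++ʳ x xC≈xCyxC ⟩
    ((x ++ C) ++ y ++ (x ++ C)) ++ x ≡⟨ solve (++-monoid A) ⟩
    (x ++ C ++ y) ++ (x ++ C ++ x)   ≈⟨ ≈-++ˡ (x ++ C ++ y) x≈xCx ⟨
    (x ++ C ++ y) ++ x               ≡⟨ solve (++-monoid A) ⟩
    x ++ (C ++ y) ++ x               ∎

  absorb : ∀ {x y} → y ⊆ x → x ≈ x ++ y ++ x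
  absorb {x} {[]}    _     = ≈-sym (unsquareʳ [] x)
  absorb {x} {c ∷ y} cy⊆x =
    absorb-++ (≈-factor (proj₂ (proj₂ (∈-∃++ (cy⊆x (here refl))))))
                (absorb λ m → xs⊆xs++ys x [ c ] (cy⊆x (there m)))

  ≈-dropMiddle : ∀ {x w z} → z ⊆ x → x ++ w ⊆ z → x ++ w ++ z ≈ x ++ z
  ≈-dropMiddle {x} {w} {z} z⊆x xw⊆z = begin
    x ++ w ++ z                ≈⟨ ≈-++ʳ (w ++ z) (absorb z⊆x) ⟩
    (x ++ z ++ x) ++ w ++ z    ≡⟨ solve (++-monoid A) ⟩
    x ++ z ++ (x ++ w) ++ z    ≈⟨ ≈-++ˡ x (absorb xw⊆z) ⟨
    x ++ z                     ∎

  ≈-prefix++suffix : ∀ {w x q r z} → w ≡ x ++ q → w ≡ r ++ z → w ⊆ x → w ⊆ z → w ≈ x ++ z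
  ≈-prefix++suffix {w} {x} {z = z} w≡xq w≡rz w⊆x w⊆z = begin
    w           ≈⟨ ≈-dupPrefix w≡xq ⟩
    x ++ w      ≈⟨ ≈-++ˡ x (≈-dupSuffix w≡rz) ⟩
    x ++ w ++ z ≈⟨ ≈-dropMiddle (w⊆x ∘ suffix⊆ w≡rz) xw⊆z ⟩
    x ++ z      ∎
    where
    xw⊆z : x ++ w ⊆ z
    xw⊆z m with ∈-++⁻ x m
    ... | inj₁ m∈x = w⊆z (prefix⊆ w≡xq m∈x)
    ... | inj₂ m∈w = w⊆z m∈w

  module _ (_≟ᴬ_ : DecidableEquality A) where
    open DecMembership _≟ᴬ_ using (_∈?_)

    record PrefixSplit (w : List A) : Set where
      constructor prefixSplit
      field
        p : List A
        a : A
        q : List A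
        w≡p++a∷q : w ≡ p ++ a ∷ q
        a∉p : a ∉ p
        w⊆p++a : w ⊆ p ++ [ a ]

    record SuffixSplit (w : List A) : Set where
      constructor suffixSplit
      field
        r : List A
        b : A
        s : List A
        w≡r++b∷s : w ≡ r ++ b ∷ s
        b∉s : b ∉ s
        w⊆b∷s : w ⊆ b ∷ s

    splitSuffix : ∀ c w → SuffixSplit (c ∷ w)
    splitSuffix c []      = suffixSplit [] c [] refl (λ ()) id
    splitSuffix c (d ∷ w) with splitSuffix d w
    ... | suffixSplit r b s eq b∉s ⊆b∷s with c ∈? b ∷ s
    ...   | yes c∈b∷s = suffixSplit (c ∷ r) b s (cong (c ∷_) eq) b∉s λ where
                          (here refl) → c∈b∷s
                          (there m)   → ⊆b∷s m
    ...   | no  c∉b∷s = suffixSplit [] c (d ∷ w) refl (c∉b∷s ∘ ⊆b∷s) id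

    splitPrefix′ : ∀ {w} → Reverse w → ∀ c → PrefixSplit (w ++ [ c ])
    splitPrefix′ []               c = prefixSplit [] c [] refl (λ ()) id
    splitPrefix′ (w ∶ rw ∶ʳ d) c with splitPrefix′ rw d
    ... | prefixSplit p a q eq a∉p ⊆p++a with c ∈? p ++ [ a ]
    ...   | no  c∉p++a = prefixSplit (w ++ [ d ]) c [] refl (c∉p++a ∘ ⊆p++a) id
    ...   | yes c∈p++a = prefixSplit p a (q ++ [ c ]) eq′ a∉p wdc⊆p++a
      where
      eq′ : (w ++ [ d ]) ++ [ c ] ≡ p ++ a ∷ q ++ [ c ]
      eq′ = trans (cong (_++ [ c ]) eq) (++-assoc p (a ∷ q) [ c ])
      wdc⊆p++a : (w ++ [ d ]) ++ [ c ] ⊆ p ++ [ a ]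
      wdc⊆p++a m with ∈-++⁻ (w ++ [ d ]) m
      ... | inj₁ m∈wd       = ⊆p++a m∈wd
      ... | inj₂ (here refl) = c∈p++a

    splitPrefix : ∀ w → w ≢ [] → PrefixSplit w
    splitPrefix w w≢[] with reverseView w
    ... | []            = ⊥-elim (w≢[] refl)
    ... | w′ ∶ rw ∶ʳ c = splitPrefix′ rw c

    ≈-split : ∀ {w p a q r b s} → w ≡ p ++ a ∷ q → w ⊆ p ++ [ a ] → w ≡ r ++ b ∷ s → w ⊆ b ∷ s →
              w ≈ p ++ a ∷ b ∷ s
    ≈-split {w} {p} {a} {q} {b = b} {s} w≡p++a∷q w⊆p++a w≡r++b∷s w⊆b∷s = begin
      w                     ≈⟨ ≈-prefix++suffix w≡pa++q w≡r++b∷s w⊆p++a w⊆b∷s ⟩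
      (p ++ [ a ]) ++ b ∷ s ≡⟨ ++-assoc p [ a ] (b ∷ s) ⟩
      p ++ a ∷ b ∷ s        ∎
      where
      w≡pa++q : w ≡ (p ++ [ a ]) ++ q
      w≡pa++q = trans w≡p++a∷q (sym (++-assoc p [ a ] q))

    _∖_ : List A → A → List A
    S ∖ a = filter (λ y → ¬? (y ≟ᴬ a)) S

    length-∖ : ∀ {a S} → a ∈ S → length (S ∖ a) < length S
    length-∖ {a} a∈S = filter-notAll (λ y → ¬? (y ≟ᴬ a)) _ (Any.map (λ { refl y≢y → y≢y refl }) a∈S)

    ⊆-∖ : ∀ {a v S} → v ⊆ S → a ∉ v → v ⊆ S ∖ a
    ⊆-∖ {a} v⊆S a∉v y∈v = ∈-filter⁺ (λ y → ¬? (y ≟ᴬ a)) (v⊆S y∈v) λ { refl → a∉v y∈v }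

    shortEquivalent : ∀ n {S} → length S ≤ n → ∀ w → w ⊆ S →
              Σ (List A) λ w′ → length w′ ≤ lengthBound n × w ≈ w′
    shortEquivalent n         _     []      _ = [] , z≤n , ε
    shortEquivalent zero    {[]} _  (x ∷ _) w⊆S with () ← w⊆S (here refl)
    shortEquivalent (suc n) {S} |S|≤ (x ∷ w) w⊆S =
      let p′ , |p′|≤ , p≈p′ = shortEquivalent n (shrink a∈S) p (⊆-∖ (w⊆S ∘ prefix⊆ w≡p++a∷q) a∉p)
          s′ , |s′|≤ , s≈s′ = shortEquivalent n (shrink b∈S) s (⊆-∖ (w⊆S ∘ suffix⊆ w≡r++b∷s ∘ there) b∉s)
      in p′ ++ a ∷ b ∷ s′
       , ≤-trans (≤-reflexive (length-++ p′)) (+-mono-≤ |p′|≤ (s≤s (s≤s |s′|≤)))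
       , (begin
           x ∷ w           ≈⟨ ≈-split w≡p++a∷q w⊆p++a w≡r++b∷s w⊆b∷s ⟩
           p ++ a ∷ b ∷ s  ≈⟨ ≈-++ p≈p′ (≈-++ˡ (a ∷ b ∷ []) s≈s′) ⟩
           p′ ++ a ∷ b ∷ s′ ∎)
      where
      open PrefixSplit (splitPrefix (x ∷ w) (λ ()))
      open SuffixSplit (splitSuffix x w)
      a∈S : a ∈ S
      a∈S = w⊆S (suffix⊆ w≡p++a∷q (here refl))
      b∈S : b ∈ S
      b∈S = w⊆S (suffix⊆ w≡r++b∷s (here refl))
      shrink : ∀ {c} → c ∈ S → length (S ∖ c) ≤ n
      shrink c∈S = ≤-pred (≤-trans (length-∖ c∈S) |S|≤)

  wordsUpTo : List A → ℕ → List (List A)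
  wordsUpTo as zero    = [ [] ]
  wordsUpTo as (suc n) = [] ∷ cartesianProductWith _∷_ as (wordsUpTo as n)

  ∈-wordsUpTo : ∀ {as} → (∀ x → x ∈ as) → ∀ {n w} → length w ≤ n → w ∈ wordsUpTo as n
  ∈-wordsUpTo _   {zero}  {[]}    _         = here refl
  ∈-wordsUpTo _   {suc n} {[]}    _         = here refl
  ∈-wordsUpTo all {suc n} {x ∷ w} (s≤s |w|≤) =
    there (∈-cartesianProductWith⁺ _∷_ (all x) (∈-wordsUpTo all |w|≤))

  fromList≢[] : ∀ (w : List A) → w ≢ [] → Σ (List⁺ A) λ W → toList W ≡ w
  fromList≢[] []      w≢[] = ⊥-elim (w≢[] refl)
  fromList≢[] (x ∷ w) _    = x List⁺.∷ w , refl

  redex≢[] : ∀ {w w′} → Reduction w w′ → w ≢ []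
  redex≢[] (U , X , V , X≢[] , refl , _) w≡[] = X≢[] (++-conicalˡ X _ (++-conicalʳ U _ w≡[]))

  reduct≢[] : ∀ {w w′} → Reduction w w′ → w′ ≢ []
  reduct≢[] (U , X , V , X≢[] , _ , refl) w′≡[] = X≢[] (++-conicalˡ X _ (++-conicalʳ U _ w′≡[]))

≈⇒Connected : ∀ {k} (W : Word k) {w′} → toList W ≈ w′ →
              Σ (Word k) λ W′ → toList W′ ≡ w′ × Connected W W′
≈⇒Connected W ε = W , refl , ε
≈⇒Connected W (fwd red ◅ rest) with W₁ , refl ← fromList≢[] _ (reduct≢[] red) =
  let W′ , eq , path = ≈⇒Connected W₁ rest in W′ , eq , inj₁ red ◅ path
≈⇒Connected W (bwd red ◅ rest) with W₁ , refl ← fromList≢[] _ (redex≢[] red) =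
  let W′ , eq , path = ≈⇒Connected W₁ rest in W′ , eq , inj₂ red ◅ path

finitelyManyComponents : ∀ k → FinitelyManyComponents k
finitelyManyComponents k = representatives , representative
  where
  representatives : List (Word k)
  representatives = cartesianProductWith List⁺._∷_ (allFin k) (wordsUpTo (allFin k) (lengthBound k))

  representative : (W : Word k) → Σ (Word k) λ R → R ∈ representatives × Connected W R
  representative W
    with w′ , |w′|≤ , W≈w′ ← shortEquivalent _≟_ k (≤-reflexive (length-tabulate id)) (toList W) (λ {x} _ → ∈-allFin x)
    with y List⁺.∷ v , refl , W~R ← ≈⇒Connected W W≈w′
    = y List⁺.∷ v
    , ∈-cartesianProductWith⁺ List⁺._∷_ (∈-allFin y) (∈-wordsUpTo ∈-allFin (≤-trans (n≤1+n _) |w′|≤))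
    , W~R

theorem2p10 : FinitelyManyComponents 3
theorem2p10 = finitelyManyComponents 3
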